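{- Consider the Vanilla algorithm run on an undirected graph $G$ with $n$ vertices. For every integer $k \ge 0$, after $k$ phases of the Vanilla algorithm, the number of ongoing vertices is at most $(7/8)^k n$ with probability at least $1 - (6/7)^k$.
   Context: Every vertex $v$ has a parent $v.p$, initially $v.p = v$; $v$ is a root iff $v.p = v$. The algorithm maintains a multiset of current edges, initially the edges of $G$; each edge $\{v,w\}$ is viewed as two arcs $(v,w)$ and $(w,v)$. The Vanilla algorithm repeats the following phase until no current edge other than loops exists: (1) random-vote: every vertex $u$ independently sets $u.l := 1$ with probability $1/2$ and $u.l := 0$ otherwise; (2) link: for every current arc $(v,w)$, if $v.l = 0$ and $w.l = 1$ then set $v.p := w$ (concurrent writes resolved arbitrarily); (3) shortcut: every vertex $u$ simultaneously sets $u.p := u.p.p$; (4) alter: every current edge $\{v,w\}$ is replaced by $\{v.p, w.p\}$. A vertex is ongoing if it is a root but not the only root among the vertices of its connected component in $G$; otherwise it is finished. -}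

module Defs where

open import Data.Nat using (ℕ; zero; suc; _+_; _*_; _∸_; _^_; _≤_)
open import Data.Bool using (Bool; true; false; not; _∧_; if_then_else_)
open import Data.Fin using (Fin; _≟_)
open import Data.Product using (_×_; _,_; ∃; Σ)
open import Data.List using (List; []; _∷_; _++_; concatMap; map; length)
open import Data.List.Membership.Propositional using (_∈_)
open import Data.List.Relation.Unary.All using (All)
open import Data.List.Relation.Unary.Unique.Propositional using (Unique)
open import Data.Vec using (Vec; []; _∷_; lookup)
open import Relation.Nullary using (¬_)
open import Relation.Nullary.Decidable using (⌊_⌋)
open import Relation.Binary.PropositionalEquality using (_≡_)

-- An undirected (multi)graph on vertex set Fin n: a list of edges {a,b},
-- each edge given as a pair (a , b) and viewed as the two arcs (a,b),(b,a).
Graph : ℕ → Set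
Graph n = List (Fin n × Fin n)

Parents : ℕ → Set
Parents n = Fin n → Fin n

-- Votes of one phase: l u = true means u.l = 1, false means u.l = 0.
Votes : ℕ → Set
Votes n = Fin n → Bool

-- Arbitrary resolution of concurrent writes: in phase t, with current parents p,
-- current edges E and votes l, vertex v whose nonempty list of competing
-- writes is (x ∷ xs) gets one of them (an index into that list).
-- The resolver may depend on everything known at that moment.
Resolver : ℕ → Set
Resolver n = ℕ → Parents n → Graph n → Votes n → (v : Fin n) →
             (x : Fin n) → (xs : List (Fin n)) → Fin (length (x ∷ xs))

State : ℕ → Set
State n = Parents n × Graph n

isLoop : ∀ {n} → Fin n × Fin n → Bool
isLoop (a , b) = ⌊ a ≟ b ⌋

allLoops : ∀ {n} → Graph n → Bool
allLoops [] = true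
allLoops (e ∷ E) = isLoop e ∧ allLoops E

arcCands : ∀ {n} → Votes n → Fin n → Fin n × Fin n → List (Fin n)
arcCands l v (a , b) =
  (if ⌊ a ≟ v ⌋ ∧ not (l a) ∧ l b then b ∷ [] else []) ++
  (if ⌊ b ≟ v ⌋ ∧ not (l b) ∧ l a then a ∷ [] else [])

cands : ∀ {n} → Graph n → Votes n → Fin n → List (Fin n)
cands E l v = concatMap (arcCands l v) E

linkStep : ∀ {n} → Resolver n → ℕ → Parents n → Graph n → Votes n → Parents n
linkStep res t p E l v with cands E l v
... | [] = p v
... | x ∷ xs = Data.List.lookup (x ∷ xs) (res t p E l v x xs)

-- One phase (t = phase index) with the given votes. If no current edge other
-- than loops exists, the algorithm has terminated and the state is unchanged.
phase : ∀ {n} → Resolver n → ℕ → State n → Votes n → State n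
phase res t (p , E) l =
  if allLoops E then (p , E)
  else (p₂ , map (λ e → (p₂ (Data.Product.proj₁ e) , p₂ (Data.Product.proj₂ e))) E)
  where
    p₁ : Parents _
    p₁ = linkStep res t p E l
    p₂ : Parents _
    p₂ u = p₁ (p₁ u)

runFrom : ∀ {n k} → Resolver n → ℕ → State n → Vec (Vec Bool n) k → State n
runFrom res t st [] = st
runFrom res t st (l ∷ ls) = runFrom res (suc t) (phase res t st (lookup l)) ls

afterPhases : ∀ {n k} → Graph n → Resolver n → Vec (Vec Bool n) k → State n
afterPhases {n} G res ω = runFrom res 0 ((λ v → v) , G) ω

data Connected {n} (G : Graph n) : Fin n → Fin n → Set where
  here : ∀ {u} → Connected G u u
  fwd  : ∀ {a b c} → (a , b) ∈ G → Connected G b c → Connected G a c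
  bwd  : ∀ {a b c} → (a , b) ∈ G → Connected G a c → Connected G b c

IsRoot : ∀ {n} → Parents n → Fin n → Set
IsRoot p v = p v ≡ v

Ongoing : ∀ {n} → Graph n → Parents n → Fin n → Set
Ongoing G p v = IsRoot p v × ∃ λ u → ¬ (u ≡ v) × IsRoot p u × Connected G u v

-- "number of ongoing vertices ≤ (7/8)^k n", i.e. every duplicate-free list of
-- ongoing vertices has length ≤ (7/8)^k n (cross-multiplied).
FewOngoing : ∀ {n} → Graph n → Parents n → ℕ → Set
FewOngoing {n} G p k =
  (vs : List (Fin n)) → Unique vs → All (Ongoing G p) vs →
  length vs * 8 ^ k ≤ 7 ^ k * n

module Submission where

-- A vertex is *active* if it is a root and an edge of G leaves its tree; ongoing
-- vertices are active, so we count active vertices.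
--  1. Invariant: before each phase the parents are flat and the current edges
--     are the edges of G relabelled by the parents.
--  2. One phase creates no active vertices, and an active v has a current
--     neighbour w ≠ v; if v votes 0 and w votes 1, v is hooked and stops being a
--     root.  Summing over all vote vectors, the expected number of active
--     vertices shrinks by 3/4 per phase, so it is at most (3/4)^k·n after k.
--  3. Markov's inequality: the count exceeds (7/8)^k·n on at most a
--     (3/4)^k / (7/8)^k = (6/7)^k fraction of the runs.

open import Defs
open import Data.Nat using (ℕ; _*_; _∸_; _^_; _≤_)
open import Data.Bool using (Bool)
open import Data.Product using (∃; _×_; proj₁)
open import Data.List using (List; length)
open import Data.List.Relation.Unary.All using (All)
open import Data.List.Relation.Unary.Unique.Propositional using (Unique)
open import Data.Vec using (Vec)

open import Data.Nat using (zero; suc; _+_; z≤n; s≤s; _≤?_)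
open import Data.Nat.Properties hiding (_≟_)
open import Data.Nat.Tactic.RingSolver using (solve-∀)
open import Data.Bool using (true; false; not; _∧_; if_then_else_)
open import Data.Fin using (Fin; _≟_) renaming (zero to fzero; suc to fsuc)
open import Data.Product using (∃₂; _,_; proj₂)
open import Data.Sum using (_⊎_; inj₁; inj₂; swap)
open import Function using (flip)
open import Data.List using ([]; _∷_; map; _++_; filter; allFin; cartesianProductWith)
open import Data.List.Properties using (map-∘; map-cong; map-id; filter-accept; filter-reject; filter-all; length-tabulate)
open import Data.List.Membership.Propositional using (_∈_; lose; find)
open import Data.List.Membership.Propositional.Properties using (∈-map⁻; ∈-map⁺; ∈-++⁻; ∈-++⁺ˡ; ∈-++⁺ʳ; ∈-lookup; ∈-filter⁺; ∈-allFin)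
open import Data.List.Relation.Unary.Any as Any using (Any; here; there)
open import Data.List.Relation.Unary.All as All using ([]; _∷_)
open import Data.List.Relation.Unary.All.Properties using (all-filter)
open import Data.List.Relation.Unary.AllPairs using ([]; _∷_)
open import Data.List.Relation.Unary.Unique.Propositional.Properties using (filter⁺; cartesianProductWith⁺)
open import Data.Vec using ([]; _∷_; lookup)
open import Data.Vec.Properties using (∷-injective)
open import Data.Empty using (⊥-elim)
open import Relation.Nullary using (¬_; Dec; yes; no)
open import Relation.Nullary.Decidable using (⌊_⌋; _×-dec_; _⊎-dec_; ¬?)
open import Relation.Unary using (Decidable)
open import Relation.Binary.PropositionalEquality

-- ∑ f xs is the sum of f over the list xs, counted with multiplicity.  Averages
-- over uniformly random votes are such sums over the list of all vote vectors.
∑ : {A : Set} → (A → ℕ) → List A → ℕ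
∑ f [] = 0
∑ f (x ∷ xs) = f x + ∑ f xs

module _ {A : Set} where

  ∑-++ : (f : A → ℕ) (xs ys : List A) → ∑ f (xs ++ ys) ≡ ∑ f xs + ∑ f ys
  ∑-++ f [] ys = refl
  ∑-++ f (x ∷ xs) ys = trans (cong (f x +_) (∑-++ f xs ys)) (sym (+-assoc (f x) _ _))

  ∑-mono : {f g : A → ℕ} → (∀ x → f x ≤ g x) → (xs : List A) → ∑ f xs ≤ ∑ g xs
  ∑-mono f≤g [] = z≤n
  ∑-mono f≤g (x ∷ xs) = +-mono-≤ (f≤g x) (∑-mono f≤g xs)

  ∑-cong : {f g : A → ℕ} → (∀ x → f x ≡ g x) → (xs : List A) → ∑ f xs ≡ ∑ g xs
  ∑-cong f≡g [] = refl
  ∑-cong f≡g (x ∷ xs) = cong₂ _+_ (f≡g x) (∑-cong f≡g xs)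

  ∑-*ʳ : (f : A → ℕ) (c : ℕ) (xs : List A) → ∑ f xs * c ≡ ∑ (λ x → f x * c) xs
  ∑-*ʳ f c [] = refl
  ∑-*ʳ f c (x ∷ xs) = trans (*-distribʳ-+ c (f x) (∑ f xs)) (cong (f x * c +_) (∑-*ʳ f c xs))

  ∑-const : (c : ℕ) (xs : List A) → ∑ (λ _ → c) xs ≡ c * length xs
  ∑-const c [] = sym (*-zeroʳ c)
  ∑-const c (x ∷ xs) = trans (cong (c +_) (∑-const c xs)) (sym (*-suc c (length xs)))

  ∑-+ : (f g : A → ℕ) (xs : List A) → ∑ (λ x → f x + g x) xs ≡ ∑ f xs + ∑ g xs
  ∑-+ f g [] = refl
  ∑-+ f g (x ∷ xs) = trans (cong (f x + g x +_) (∑-+ f g xs)) (interchange (f x) (g x) _ _)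
    where
      interchange : ∀ a b c d → a + b + (c + d) ≡ a + c + (b + d)
      interchange = solve-∀

  length≡∑1 : (xs : List A) → length xs ≡ ∑ (λ _ → 1) xs
  length≡∑1 xs = sym (trans (∑-const 1 xs) (*-identityˡ (length xs)))

∑-map : {A B : Set} (f : B → ℕ) (g : A → B) (xs : List A) → ∑ f (map g xs) ≡ ∑ (λ x → f (g x)) xs
∑-map f g [] = refl
∑-map f g (x ∷ xs) = cong (f (g x) +_) (∑-map f g xs)

∑-swap : {A B : Set} (h : A → B → ℕ) (xs : List A) (ys : List B) →
  ∑ (λ x → ∑ (h x) ys) xs ≡ ∑ (λ y → ∑ (λ x → h x y) xs) ys
∑-swap h [] ys = sym (∑-const 0 ys)
∑-swap h (x ∷ xs) ys =
  trans (cong (∑ (h x) ys +_) (∑-swap h xs ys)) (sym (∑-+ (h x) (λ y → ∑ (λ x′ → h x′ y) xs) ys))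

∑-product : {A B C : Set} (g : A → B → C) (f : C → ℕ) (xs : List A) (ys : List B) →
  ∑ f (cartesianProductWith g xs ys) ≡ ∑ (λ x → ∑ (λ y → f (g x y)) ys) xs
∑-product g f [] ys = refl
∑-product g f (x ∷ xs) ys = begin
  ∑ f (map (g x) ys ++ cartesianProductWith g xs ys)
    ≡⟨ ∑-++ f (map (g x) ys) _ ⟩
  ∑ f (map (g x) ys) + ∑ f (cartesianProductWith g xs ys)
    ≡⟨ cong₂ _+_ (∑-map f (g x) ys) (∑-product g f xs ys) ⟩
  ∑ (λ y → f (g x y)) ys + ∑ (λ x′ → ∑ (λ y → f (g x′ y)) ys) xs ∎
  where open ≡-Reasoning

𝟙 : {P : Set} → Dec P → ℕ
𝟙 (yes _) = 1
𝟙 (no _) = 0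

𝟙≤1 : {P : Set} (d : Dec P) → 𝟙 d ≤ 1
𝟙≤1 (yes _) = s≤s z≤n
𝟙≤1 (no _) = z≤n

𝟙-false : {P : Set} → ¬ P → (d : Dec P) → 𝟙 d ≡ 0
𝟙-false ¬p (yes p) = ⊥-elim (¬p p)
𝟙-false ¬p (no _) = refl

length-filter≡∑𝟙 : {A : Set} {P : A → Set} (P? : Decidable P) (xs : List A) →
  length (filter P? xs) ≡ ∑ (λ x → 𝟙 (P? x)) xs
length-filter≡∑𝟙 P? [] = refl
length-filter≡∑𝟙 P? (x ∷ xs) with P? x
... | yes _ = cong suc (length-filter≡∑𝟙 P? xs)
... | no _ = length-filter≡∑𝟙 P? xs

module _ {A : Set} where

  delete : (ys : List A) {x : A} → x ∈ ys → List A
  delete (y ∷ ys) (here _) = ys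
  delete (y ∷ ys) (there x∈ys) = y ∷ delete ys x∈ys

  length-delete : (ys : List A) {x : A} (x∈ys : x ∈ ys) → suc (length (delete ys x∈ys)) ≡ length ys
  length-delete (y ∷ ys) (here _) = refl
  length-delete (y ∷ ys) (there x∈ys) = cong suc (length-delete ys x∈ys)

  ∈-delete : (ys : List A) {x z : A} (x∈ys : x ∈ ys) → z ∈ ys → ¬ z ≡ x → z ∈ delete ys x∈ys
  ∈-delete (y ∷ ys) (here refl) (here refl) z≢x = ⊥-elim (z≢x refl)
  ∈-delete (y ∷ ys) (here refl) (there z∈ys) z≢x = z∈ys
  ∈-delete (y ∷ ys) (there x∈ys) (here refl) z≢x = here refl
  ∈-delete (y ∷ ys) (there x∈ys) (there z∈ys) z≢x = there (∈-delete ys x∈ys z∈ys z≢x)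

  ∉-head : {x z : A} {vs : List A} → All (λ w → ¬ x ≡ w) vs → z ∈ vs → ¬ z ≡ x
  ∉-head (x≢w ∷ _) (here refl) z≡x = x≢w (sym z≡x)
  ∉-head (_ ∷ x∉vs) (there z∈vs) z≡x = ∉-head x∉vs z∈vs z≡x

  unique-⊆-length : (vs ys : List A) → Unique vs → (∀ {x} → x ∈ vs → x ∈ ys) → length vs ≤ length ys
  unique-⊆-length [] ys _ _ = z≤n
  unique-⊆-length (v ∷ vs) ys (v∉vs ∷ uvs) vs⊆ys =
    subst (suc (length vs) ≤_) (length-delete ys v∈ys)
      (s≤s (unique-⊆-length vs (delete ys v∈ys) uvs
        (λ x∈vs → ∈-delete ys v∈ys (vs⊆ys (there x∈vs)) (∉-head v∉vs x∈vs))))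
    where
      v∈ys : v ∈ ys
      v∈ys = vs⊆ys (here refl)

vectors : {A : Set} → List A → (k : ℕ) → List (Vec A k)
vectors xs zero = [] ∷ []
vectors xs (suc k) = cartesianProductWith _∷_ xs (vectors xs k)

module _ {A : Set} where

  length-vectors : (xs : List A) (k : ℕ) → length (vectors xs k) ≡ length xs ^ k
  length-vectors xs zero = refl
  length-vectors xs (suc k) = begin
    length (vectors xs (suc k))                ≡⟨ length≡∑1 (vectors xs (suc k)) ⟩
    ∑ (λ _ → 1) (vectors xs (suc k))           ≡⟨ ∑-product _∷_ (λ _ → 1) xs (vectors xs k) ⟩
    ∑ (λ _ → ∑ (λ _ → 1) (vectors xs k)) xs    ≡⟨ ∑-const _ xs ⟩
    ∑ (λ _ → 1) (vectors xs k) * length xs     ≡⟨ cong (_* length xs) (sym (length≡∑1 (vectors xs k))) ⟩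
    length (vectors xs k) * length xs          ≡⟨ cong (_* length xs) (length-vectors xs k) ⟩
    length xs ^ k * length xs                  ≡⟨ *-comm (length xs ^ k) (length xs) ⟩
    length xs ^ suc k                          ∎
    where open ≡-Reasoning

  vectors-unique : (xs : List A) (k : ℕ) → Unique xs → Unique (vectors xs k)
  vectors-unique xs zero _ = [] ∷ []
  vectors-unique xs (suc k) uxs =
    cartesianProductWith⁺ _∷_ ∷-injective uxs (vectors-unique xs k uxs)

voteVectors : (m : ℕ) → List (Vec Bool m)
voteVectors m = vectors (true ∷ false ∷ []) m

voteVectors-unique : (m : ℕ) → Unique (voteVectors m)
voteVectors-unique m = vectors-unique _ m (((λ ()) ∷ []) ∷ [] ∷ [])

length-voteVectors : (m : ℕ) → length (voteVectors m) ≡ 2 ^ m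
length-voteVectors m = length-vectors _ m

∑-voteVectors-suc : ∀ {m} (f : Vec Bool (suc m) → ℕ) →
  ∑ f (voteVectors (suc m)) ≡ ∑ (λ x → f (true ∷ x)) (voteVectors m) + ∑ (λ x → f (false ∷ x)) (voteVectors m)
∑-voteVectors-suc {m} f =
  trans (∑-product _∷_ f (true ∷ false ∷ []) (voteVectors m)) (cong (∑ (λ x → f (true ∷ x)) (voteVectors m) +_) (+-identityʳ _))

∑-coordinate : ∀ {m} (F : Bool → ℕ) (j : Fin m) →
  ∑ (λ x → F (lookup x j)) (voteVectors m) * 2 ≡ (F true + F false) * 2 ^ m
∑-coordinate {suc m} F fzero = begin
  ∑ (λ x → F (lookup x fzero)) (voteVectors (suc m)) * 2
    ≡⟨ cong (_* 2) (∑-voteVectors-suc {m} (λ x → F (lookup x fzero))) ⟩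
  (∑ (λ _ → F true) V + ∑ (λ _ → F false) V) * 2
    ≡⟨ cong₂ (λ a b → (a + b) * 2) (∑-const (F true) V) (∑-const (F false) V) ⟩
  (F true * length V + F false * length V) * 2
    ≡⟨ cong (λ c → (F true * c + F false * c) * 2) (length-voteVectors m) ⟩
  (F true * 2 ^ m + F false * 2 ^ m) * 2
    ≡⟨ regroup (F true) (F false) (2 ^ m) ⟩
  (F true + F false) * 2 ^ suc m ∎
  where
    open ≡-Reasoning
    V : List (Vec Bool m)
    V = voteVectors m
    regroup : ∀ a b c → (a * c + b * c) * 2 ≡ (a + b) * (2 * c)
    regroup = solve-∀
∑-coordinate {suc m} F (fsuc j) = begin
  ∑ (λ x → F (lookup x (fsuc j))) (voteVectors (suc m)) * 2
    ≡⟨ cong (_* 2) (∑-voteVectors-suc {m} (λ x → F (lookup x (fsuc j)))) ⟩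
  (S + S) * 2               ≡⟨ regroup S ⟩
  2 * (S * 2)               ≡⟨ cong (2 *_) (∑-coordinate F j) ⟩
  2 * ((F true + F false) * 2 ^ m)
    ≡⟨ regroup′ (F true + F false) (2 ^ m) ⟩
  (F true + F false) * 2 ^ suc m ∎
  where
    open ≡-Reasoning
    S : ℕ
    S = ∑ (λ x → F (lookup x j)) (voteVectors m)
    regroup : ∀ a → (a + a) * 2 ≡ 2 * (a * 2)
    regroup = solve-∀
    regroup′ : ∀ a c → 2 * (a * c) ≡ a * (2 * c)
    regroup′ = solve-∀

∑-two-coordinates : ∀ {m} (F : Bool → Bool → ℕ) (i j : Fin m) → ¬ i ≡ j →
  ∑ (λ x → F (lookup x i) (lookup x j)) (voteVectors m) * 4 ≡
    (F true true + F true false + F false true + F false false) * 2 ^ m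
∑-two-coordinates F fzero fzero i≢j = ⊥-elim (i≢j refl)
∑-two-coordinates {suc m} F fzero (fsuc j) _ = begin
  ∑ (λ x → F (lookup x fzero) (lookup x (fsuc j))) (voteVectors (suc m)) * 4
    ≡⟨ cong (_* 4) (∑-voteVectors-suc {m} (λ x → F (lookup x fzero) (lookup x (fsuc j)))) ⟩
  (S₁ + S₀) * 4                   ≡⟨ regroup S₁ S₀ ⟩
  2 * (S₁ * 2) + 2 * (S₀ * 2)     ≡⟨ cong₂ (λ a b → 2 * a + 2 * b) (∑-coordinate (F true) j) (∑-coordinate (F false) j) ⟩
  2 * ((F true true + F true false) * 2 ^ m) + 2 * ((F false true + F false false) * 2 ^ m)
    ≡⟨ regroup′ (F true true) (F true false) (F false true) (F false false) (2 ^ m) ⟩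
  (F true true + F true false + F false true + F false false) * 2 ^ suc m ∎
  where
    open ≡-Reasoning
    S₁ S₀ : ℕ
    S₁ = ∑ (λ x → F true (lookup x j)) (voteVectors m)
    S₀ = ∑ (λ x → F false (lookup x j)) (voteVectors m)
    regroup : ∀ a b → (a + b) * 4 ≡ 2 * (a * 2) + 2 * (b * 2)
    regroup = solve-∀
    regroup′ : ∀ a b c d e → 2 * ((a + b) * e) + 2 * ((c + d) * e) ≡ (a + b + c + d) * (2 * e)
    regroup′ = solve-∀
∑-two-coordinates {suc m} F (fsuc i) fzero _ =
  trans (∑-two-coordinates (flip F) fzero (fsuc i) (λ ()))
        (cong (_* 2 ^ suc m) (swap-middle (F true true) (F false true) (F true false) (F false false)))
  where
    swap-middle : ∀ a b c d → a + b + c + d ≡ a + c + b + d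
    swap-middle = solve-∀
∑-two-coordinates {suc m} F (fsuc i) (fsuc j) i≢j = begin
  ∑ (λ x → F (lookup x (fsuc i)) (lookup x (fsuc j))) (voteVectors (suc m)) * 4
    ≡⟨ cong (_* 4) (∑-voteVectors-suc {m} (λ x → F (lookup x (fsuc i)) (lookup x (fsuc j)))) ⟩
  (S + S) * 4             ≡⟨ *-distribʳ-+ 4 S S ⟩
  S * 4 + S * 4           ≡⟨ cong₂ _+_ IH IH ⟩
  T * 2 ^ m + T * 2 ^ m   ≡⟨ regroup T (2 ^ m) ⟩
  T * 2 ^ suc m ∎
  where
    open ≡-Reasoning
    S T : ℕ
    S = ∑ (λ x → F (lookup x i) (lookup x j)) (voteVectors m)
    T = F true true + F true false + F false true + F false false
    IH : S * 4 ≡ T * 2 ^ m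
    IH = ∑-two-coordinates F i j (λ i≡j → i≢j (cong fsuc i≡j))
    regroup : ∀ a e → a * e + a * e ≡ a * (2 * e)
    regroup = solve-∀

Adjacent : ∀ {n} → Graph n → Fin n → Fin n → Set
Adjacent E v w = (v , w) ∈ E ⊎ (w , v) ∈ E

guard-sound : ∀ {n} (l : Votes n) (a b v : Fin n) →
  (⌊ a ≟ v ⌋ ∧ not (l a) ∧ l b) ≡ true → a ≡ v × l a ≡ false × l b ≡ true
guard-sound l a b v g with a ≟ v | l a | l b
guard-sound l a b v g  | yes a≡v | false | true = a≡v , refl , refl
guard-sound l a b v () | no _    | _     | _
guard-sound l a b v () | yes _   | true  | _
guard-sound l a b v () | yes _   | false | false

guard-complete : ∀ {n} (l : Votes n) (v w : Fin n) → l v ≡ false → l w ≡ true →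
  (⌊ v ≟ v ⌋ ∧ not (l v) ∧ l w) ≡ true
guard-complete l v w lv lw with v ≟ v
... | yes _ rewrite lv | lw = refl
... | no v≢v = ⊥-elim (v≢v refl)

∈-if : {A : Set} {B : Bool} {b c : A} → c ∈ (if B then b ∷ [] else []) → B ≡ true × c ≡ b
∈-if {B = true} (here c≡b) = refl , c≡b

arcCands-sound : ∀ {n} (l : Votes n) (v : Fin n) (e : Fin n × Fin n) {c : Fin n} →
  c ∈ arcCands l v e → l v ≡ false × l c ≡ true × (e ≡ (v , c) ⊎ e ≡ (c , v))
arcCands-sound l v (a , b) c∈ with ∈-++⁻ (if ⌊ a ≟ v ⌋ ∧ not (l a) ∧ l b then b ∷ [] else []) c∈
... | inj₁ c∈₁ with ∈-if c∈₁
...   | g , refl with guard-sound l a b v g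
...     | refl , la , lb = la , lb , inj₁ refl
arcCands-sound l v (a , b) c∈ | inj₂ c∈₂ with ∈-if c∈₂
...   | g , refl with guard-sound l b a v g
...     | refl , lb , la = lb , la , inj₂ refl

cands-sound : ∀ {n} (l : Votes n) (v : Fin n) (E : Graph n) {c : Fin n} →
  c ∈ cands E l v → l v ≡ false × l c ≡ true × Adjacent E v c
cands-sound l v (e ∷ E) c∈ with ∈-++⁻ (arcCands l v e) c∈
... | inj₁ c∈e with arcCands-sound l v e c∈e
...   | lv , lc , inj₁ refl = lv , lc , inj₁ (here refl)
...   | lv , lc , inj₂ refl = lv , lc , inj₂ (here refl)
cands-sound l v (e ∷ E) c∈ | inj₂ c∈E with cands-sound l v E c∈E
...   | lv , lc , inj₁ vc = lv , lc , inj₁ (there vc)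
...   | lv , lc , inj₂ cv = lv , lc , inj₂ (there cv)

cands-complete : ∀ {n} (l : Votes n) (v : Fin n) (E : Graph n) {w : Fin n} →
  l v ≡ false → l w ≡ true → Adjacent E v w → w ∈ cands E l v
cands-complete l v (e ∷ E) {w} lv lw (inj₁ (here refl)) =
  ∈-++⁺ˡ (∈-++⁺ˡ (subst (λ B → w ∈ (if B then w ∷ [] else [])) (sym (guard-complete l v w lv lw)) (here refl)))
cands-complete l v (e ∷ E) {w} lv lw (inj₂ (here refl)) =
  ∈-++⁺ˡ (∈-++⁺ʳ (if ⌊ w ≟ v ⌋ ∧ not (l w) ∧ l v then v ∷ [] else [])
    (subst (λ B → w ∈ (if B then w ∷ [] else [])) (sym (guard-complete l v w lv lw)) (here refl)))
cands-complete l v (e ∷ E) lv lw (inj₁ (there vw)) = ∈-++⁺ʳ (arcCands l v e) (cands-complete l v E lv lw (inj₁ vw))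
cands-complete l v (e ∷ E) lv lw (inj₂ (there wv)) = ∈-++⁺ʳ (arcCands l v e) (cands-complete l v E lv lw (inj₂ wv))

Leaves : ∀ {n} → Parents n → Fin n → Fin n × Fin n → Set
Leaves q v (a , b) = ¬ q a ≡ q b × (q a ≡ v ⊎ q b ≡ v)

Active : ∀ {n} → Graph n → Parents n → Fin n → Set
Active G q v = IsRoot q v × Any (Leaves q v) G

Active? : ∀ {n} (G : Graph n) (q : Parents n) (v : Fin n) → Dec (Active G q v)
Active? G q v = (q v ≟ v) ×-dec Any.any? Leaves? G
  where
    Leaves? : ∀ e → Dec (Leaves q v e)
    Leaves? (a , b) = ¬? (q a ≟ q b) ×-dec ((q a ≟ v) ⊎-dec (q b ≟ v))

activeCount : ∀ {n} → Graph n → Parents n → ℕ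
activeCount {n} G q = ∑ (λ v → 𝟙 (Active? G q v)) (allFin n)

activeCount≤n : ∀ {n} (G : Graph n) (q : Parents n) → activeCount G q ≤ n
activeCount≤n {n} G q = begin
  activeCount G q          ≤⟨ ∑-mono (λ v → 𝟙≤1 (Active? G q v)) (allFin n) ⟩
  ∑ (λ _ → 1) (allFin n)   ≡⟨ sym (length≡∑1 (allFin n)) ⟩
  length (allFin n)        ≡⟨ length-tabulate (λ v → v) ⟩
  n                        ∎
  where open ≤-Reasoning

leaving-edge : ∀ {n} {G : Graph n} {q : Parents n} {v a b : Fin n} →
  Adjacent G a b → ¬ q a ≡ q b → q a ≡ v → Any (Leaves q v) G
leaving-edge (inj₁ ab) qa≢qb qa≡v = lose ab (qa≢qb , inj₁ qa≡v)
leaving-edge (inj₂ ba) qa≢qb qa≡v = lose ba ((λ e → qa≢qb (sym e)) , inj₂ qa≡v)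

path-leaves : ∀ {n} (G : Graph n) (q : Parents n) {a c : Fin n} →
  Connected G a c → ¬ q a ≡ q c → Any (Leaves q (q c)) G
path-leaves G q here qa≢qc = ⊥-elim (qa≢qc refl)
path-leaves G q (fwd {b = b} {c} ab bc) qa≢qc with q b ≟ q c
... | yes qb≡qc = leaving-edge (inj₂ ab) (λ e → qa≢qc (trans (sym e) qb≡qc)) qb≡qc
... | no qb≢qc = path-leaves G q bc qb≢qc
path-leaves G q (bwd {a} {b} {c} ab ac) qb≢qc with q a ≟ q c
... | yes qa≡qc = leaving-edge (inj₁ ab) (λ e → qb≢qc (trans (sym e) qa≡qc)) qa≡qc
... | no qa≢qc = path-leaves G q ac qa≢qc

ongoing⇒active : ∀ {n} (G : Graph n) (q : Parents n) {v : Fin n} → Ongoing G q v → Active G q v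
ongoing⇒active G q (root , u , u≢v , rootu , path) =
  root , subst (λ z → Any (Leaves q z) G) root
           (path-leaves G q path (λ e → u≢v (trans (sym rootu) (trans e root))))

ongoing≤activeCount : ∀ {n} (G : Graph n) (q : Parents n) (vs : List (Fin n)) →
  Unique vs → All (Ongoing G q) vs → length vs ≤ activeCount G q
ongoing≤activeCount {n} G q vs unique ongoing =
  subst (length vs ≤_) (length-filter≡∑𝟙 (Active? G q) (allFin n))
    (unique-⊆-length vs (filter (Active? G q) (allFin n)) unique
      (λ v∈vs → ∈-filter⁺ (Active? G q) (∈-allFin _) (ongoing⇒active G q (All.lookup ongoing v∈vs))))

relabel : ∀ {n} → Parents n → Graph n → Graph n
relabel q E = map (λ e → (q (proj₁ e) , q (proj₂ e))) E

-- Every parent is a root (the trees have depth at most one).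
Flat : ∀ {n} → Parents n → Set
Flat p = ∀ u → p (p u) ≡ p u

WellFormed : ∀ {n} → Graph n → Parents n → Graph n → Set
WellFormed G p E = Flat p × E ≡ relabel p G

afterShortcut : ∀ {n} → Resolver n → ℕ → Parents n → Graph n → Votes n → Parents n
afterShortcut res t p E l u = linkStep res t p E l (linkStep res t p E l u)

phase-running : ∀ {n} (res : Resolver n) t p E (l : Votes n) → allLoops E ≡ false →
  phase res t (p , E) l ≡ (afterShortcut res t p E l , relabel (afterShortcut res t p E l) E)
phase-running res t p E l running rewrite running = refl

allLoops-sound : ∀ {n} (E : Graph n) → allLoops E ≡ true → ∀ {x y} → (x , y) ∈ E → x ≡ y
allLoops-sound ((a , b) ∷ E) loops xy with a ≟ b
allLoops-sound ((a , b) ∷ E) loops (here refl) | yes a≡b = a≡b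
allLoops-sound ((a , b) ∷ E) loops (there xy) | yes _ = allLoops-sound E loops xy
allLoops-sound ((a , b) ∷ E) () xy | no _

module CurrentEdges {n : ℕ} (G : Graph n) (p : Parents n) (E : Graph n) (E≡ : E ≡ relabel p G) where

  relabelled-edge : ∀ {a b} → Adjacent G a b → Adjacent E (p a) (p b)
  relabelled-edge (inj₁ ab) = inj₁ (subst (_ ∈_) (sym E≡) (∈-map⁺ (λ e → (p (proj₁ e) , p (proj₂ e))) ab))
  relabelled-edge (inj₂ ba) = inj₂ (subst (_ ∈_) (sym E≡) (∈-map⁺ (λ e → (p (proj₁ e) , p (proj₂ e))) ba))

  edge-origin : ∀ {x y} → Adjacent E x y → ∃₂ λ a b → Adjacent G a b × p a ≡ x × p b ≡ y
  edge-origin (inj₁ xy) with ∈-map⁻ (λ e → (p (proj₁ e) , p (proj₂ e))) (subst (_ ∈_) E≡ xy)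
  ... | (a , b) , ab , refl = a , b , inj₁ ab , refl , refl
  edge-origin (inj₂ yx) with ∈-map⁻ (λ e → (p (proj₁ e) , p (proj₂ e))) (subst (_ ∈_) E≡ yx)
  ... | (b , a) , ba , refl = a , b , inj₂ ba , refl , refl

  edge-roots : Flat p → ∀ {x y} → Adjacent E x y → IsRoot p x × IsRoot p y
  edge-roots flat adj with edge-origin adj
  ... | a , b , _ , refl , refl = flat a , flat b

  active-neighbour : ∀ {v} → Active G p v → ∃ λ w → ¬ w ≡ v × Adjacent E v w
  active-neighbour (_ , leaves) with find leaves
  ... | (a , b) , ab , pa≢pb , inj₁ refl = p b , (λ e → pa≢pb (sym e)) , relabelled-edge (inj₁ ab)
  ... | (a , b) , ab , pa≢pb , inj₂ refl = p a , pa≢pb , relabelled-edge (inj₂ ab)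

  active⇒running : ∀ {v} → Active G p v → allLoops E ≡ false
  active⇒running active with allLoops E in loops | active-neighbour active
  ... | false | _ = refl
  ... | true | w , w≢v , inj₁ vw = ⊥-elim (w≢v (sym (allLoops-sound E loops vw)))
  ... | true | w , w≢v , inj₂ wv = ⊥-elim (w≢v (allLoops-sound E loops wv))

module LinkPhase {n : ℕ} (G : Graph n) (res : Resolver n) (t : ℕ) (p : Parents n) (E : Graph n)
                 (flat : Flat p) (E≡ : E ≡ relabel p G) (l : Votes n) where

  open CurrentEdges G p E E≡

  p₁ : Parents n
  p₁ = linkStep res t p E l

  p₂ : Parents n
  p₂ = afterShortcut res t p E l

  link-choice : ∀ v → (cands E l v ≡ [] × p₁ v ≡ p v) ⊎ p₁ v ∈ cands E l v
  link-choice v with cands E l v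
  ... | [] = inj₁ (refl , refl)
  ... | x ∷ xs = inj₂ (∈-lookup {xs = x ∷ xs} (res t p E l v x xs))

  -- Hooking targets are current neighbours, hence roots of p.
  link-root : ∀ u → IsRoot p (p₁ u)
  link-root u with link-choice u
  ... | inj₁ (_ , kept) rewrite kept = flat u
  ... | inj₂ c with cands-sound l u E c
  ...   | _ , _ , adj = proj₂ (edge-roots flat adj)

  link-vote1 : ∀ v → l v ≡ true → p₁ v ≡ p v
  link-vote1 v lv with link-choice v
  ... | inj₁ (_ , kept) = kept
  ... | inj₂ c with cands-sound l v E c
  ...   | lv′ , _ , _ = ⊥-elim (true≢false (trans (sym lv) lv′))
    where
      true≢false : ¬ true ≡ false
      true≢false ()

  link-roots-only : ∀ u → p₁ u ≡ p u ⊎ IsRoot p u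
  link-roots-only u with link-choice u
  ... | inj₁ (_ , kept) = inj₁ kept
  ... | inj₂ c with cands-sound l u E c
  ...   | _ , _ , adj = inj₂ (proj₁ (edge-roots flat adj))

  -- A root and its new parent: the target of a hook votes 1 and does not move.
  link-twice : ∀ x → IsRoot p x → p₁ (p₁ x) ≡ p₁ x
  link-twice x root with link-choice x
  ... | inj₁ (_ , kept) rewrite trans kept root = trans kept root
  ... | inj₂ c with cands-sound l x E c
  ...   | _ , lc , _ = trans (link-vote1 (p₁ x) lc) (link-root x)

  p₂-flat : Flat p₂
  p₂-flat u = trans (cong p₁ (link-twice (p₁ u) (link-root u))) (link-twice (p₁ u) (link-root u))

  p₂-absorbs-p : ∀ u → p₂ (p u) ≡ p₂ u
  p₂-absorbs-p u with link-roots-only u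
  ... | inj₁ kept rewrite kept = link-twice (p u) (flat u)
  ... | inj₂ root rewrite root = refl

  p₂-root⇒p-root : ∀ v → IsRoot p₂ v → IsRoot p v
  p₂-root⇒p-root v root = subst (IsRoot p) root (link-root (p₁ v))

  wellFormed : WellFormed G p₂ (relabel p₂ E)
  wellFormed = p₂-flat , relabel-twice
    where
      relabel-twice : relabel p₂ E ≡ relabel p₂ G
      relabel-twice = trans (cong (relabel p₂) E≡)
        (trans (sym (map-∘ G)) (map-cong (λ e → cong₂ _,_ (p₂-absorbs-p (proj₁ e)) (p₂-absorbs-p (proj₂ e))) G))

  hooked-not-root : ∀ v w → Adjacent E v w → l v ≡ false → l w ≡ true → ¬ IsRoot p₂ v
  hooked-not-root v w adj lv lw root with link-choice v
  ... | inj₁ (none , _) with subst (w ∈_) none (cands-complete l v E lv lw adj)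
  ...   | ()
  hooked-not-root v w adj lv lw root | inj₂ c with cands-sound l v E c
  ...   | _ , lc , _ = false≢true (trans (sym lv) (subst (λ z → l z ≡ true) stays lc))
    where
      false≢true : ¬ false ≡ true
      false≢true ()
      stays : p₁ v ≡ v
      stays = trans (sym (trans (link-vote1 (p₁ v) lc) (link-root v))) root

  -- An edge of G leaving the new tree of v left the old tree of p a; if that is
  -- not v, then p a hooked onto v, and the current edge used for it comes from
  -- an edge of G leaving the old tree of v.
  leaves-before : ∀ v a b → Adjacent G a b → ¬ p₂ a ≡ p₂ b → p₂ a ≡ v → Any (Leaves p v) G
  leaves-before v a b ab p₂a≢p₂b p₂a≡v with p a ≟ v
  ... | yes pa≡v = leaving-edge ab pa≢pb pa≡v
    where
      pa≢pb : ¬ p a ≡ p b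
      pa≢pb e = p₂a≢p₂b (trans (sym (p₂-absorbs-p a)) (trans (cong p₂ e) (p₂-absorbs-p b)))
  ... | no pa≢v with link-choice (p a)
  ...   | inj₁ (_ , kept) = ⊥-elim (pa≢v (trans (sym fixed) (trans (p₂-absorbs-p a) p₂a≡v)))
    where
      fixed : p₂ (p a) ≡ p a
      fixed = trans (cong p₁ (trans kept (flat a))) (trans kept (flat a))
  ...   | inj₂ c with cands-sound l (p a) E c
  ...     | _ , lc , adj with edge-origin adj
  ...       | a′ , b′ , a′b′ , pa′≡pa , pb′≡target =
    leaving-edge (swap a′b′) (λ e → pa≢v (trans (sym pa′≡pa) (trans (sym e) pb′≡v))) pb′≡v
    where
      target≡v : p₁ (p a) ≡ v
      target≡v = trans (sym (trans (link-vote1 (p₁ (p a)) lc) (link-root (p a)))) (trans (p₂-absorbs-p a) p₂a≡v)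
      pb′≡v : p b′ ≡ v
      pb′≡v = trans pb′≡target target≡v

  active-before : ∀ v → Active G p₂ v → Active G p v
  active-before v (root , leaves) with find leaves
  ... | (a , b) , ab , ne , inj₁ ea = p₂-root⇒p-root v root , leaves-before v a b (inj₁ ab) ne ea
  ... | (a , b) , ab , ne , inj₂ eb = p₂-root⇒p-root v root , leaves-before v b a (inj₂ ab) (λ e → ne (sym e)) eb

phase-wellFormed : ∀ {n} (G : Graph n) (res : Resolver n) t p E (l : Votes n) → WellFormed G p E →
  WellFormed G (proj₁ (phase res t (p , E) l)) (proj₂ (phase res t (p , E) l))
phase-wellFormed G res t p E l (flat , E≡) with allLoops E
... | true = flat , E≡
... | false = LinkPhase.wellFormed G res t p E flat E≡ l

active-after⇒before : ∀ {n} (G : Graph n) (res : Resolver n) t p E (l : Votes n) → WellFormed G p E →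
  ∀ v → Active G (proj₁ (phase res t (p , E) l)) v → Active G p v
active-after⇒before G res t p E l (flat , E≡) v with allLoops E
... | true = λ active → active
... | false = LinkPhase.active-before G res t p E flat E≡ l v

notHooked : Bool → Bool → ℕ
notHooked false true = 0
notHooked _     _    = 1

voteSequences : (n k : ℕ) → List (Vec (Vec Bool n) k)
voteSequences n k = vectors (voteVectors n) k

length-voteSequences : (n k : ℕ) → length (voteSequences n k) ≡ (2 ^ n) ^ k
length-voteSequences n k = trans (length-vectors (voteVectors n) k) (cong (_^ k) (length-voteVectors n))

module Expectation {n : ℕ} (G : Graph n) (res : Resolver n) where

  after : ℕ → Parents n → Graph n → Vec Bool n → Parents n
  after t p E x = proj₁ (phase res t (p , E) (lookup x))

  -- An active vertex survives the phase for at most 3/4 of the votes (it is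
  -- hooked whenever it votes 0 and a current neighbour votes 1); an inactive
  -- vertex never becomes active.
  survival : ∀ t p E → WellFormed G p E → ∀ v →
    ∑ (λ x → 𝟙 (Active? G (after t p E x) v)) (voteVectors n) * 4 ≤ 𝟙 (Active? G p v) * (3 * 2 ^ n)
  survival t p E wf v with Active? G p v
  ... | no inactive =
    ≤-reflexive (cong (_* 4) (trans (∑-cong stays-inactive (voteVectors n)) (∑-const 0 (voteVectors n))))
    where
      stays-inactive : ∀ x → 𝟙 (Active? G (after t p E x) v) ≡ 0
      stays-inactive x = 𝟙-false (λ a → inactive (active-after⇒before G res t p E (lookup x) wf v a)) _
  ... | yes active with CurrentEdges.active-neighbour G p E (proj₂ wf) active
  ...   | w , w≢v , adj = begin
    ∑ (λ x → 𝟙 (Active? G (after t p E x) v)) (voteVectors n) * 4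
      ≤⟨ *-monoˡ-≤ 4 (∑-mono bound (voteVectors n)) ⟩
    ∑ (λ x → notHooked (lookup x v) (lookup x w)) (voteVectors n) * 4
      ≡⟨ ∑-two-coordinates notHooked v w (λ v≡w → w≢v (sym v≡w)) ⟩
    3 * 2 ^ n
      ≡⟨ sym (*-identityˡ _) ⟩
    1 * (3 * 2 ^ n) ∎
    where
      open ≤-Reasoning
      running : allLoops E ≡ false
      running = CurrentEdges.active⇒running G p E (proj₂ wf) active
      hooked : ∀ l → l v ≡ false → l w ≡ true → ¬ IsRoot (afterShortcut res t p E l) v
      hooked l = LinkPhase.hooked-not-root G res t p E (proj₁ wf) (proj₂ wf) l v w adj
      bound : ∀ x → 𝟙 (Active? G (after t p E x) v) ≤ notHooked (lookup x v) (lookup x w)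
      bound x rewrite phase-running res t p E (lookup x) running with lookup x v in lv | lookup x w in lw
      ... | true  | _     = 𝟙≤1 _
      ... | false | false = 𝟙≤1 _
      ... | false | true  = ≤-reflexive (𝟙-false (λ a → hooked (lookup x) lv lw (proj₁ a)) _)

  one-phase : ∀ t p E → WellFormed G p E →
    ∑ (λ x → activeCount G (after t p E x)) (voteVectors n) * 4 ≤ activeCount G p * (3 * 2 ^ n)
  one-phase t p E wf = begin
    ∑ (λ x → activeCount G (after t p E x)) (voteVectors n) * 4
      ≡⟨ cong (_* 4) (∑-swap (λ x v → 𝟙 (Active? G (after t p E x) v)) (voteVectors n) (allFin n)) ⟩
    ∑ (λ v → ∑ (λ x → 𝟙 (Active? G (after t p E x) v)) (voteVectors n)) (allFin n) * 4
      ≡⟨ ∑-*ʳ _ 4 (allFin n) ⟩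
    ∑ (λ v → ∑ (λ x → 𝟙 (Active? G (after t p E x) v)) (voteVectors n) * 4) (allFin n)
      ≤⟨ ∑-mono (survival t p E wf) (allFin n) ⟩
    ∑ (λ v → 𝟙 (Active? G p v) * (3 * 2 ^ n)) (allFin n)
      ≡⟨ sym (∑-*ʳ _ (3 * 2 ^ n) (allFin n)) ⟩
    activeCount G p * (3 * 2 ^ n) ∎
    where open ≤-Reasoning

  k-phases : ∀ k t p E → WellFormed G p E →
    ∑ (λ ω → activeCount G (proj₁ (runFrom res t (p , E) ω))) (voteSequences n k) * 4 ^ k
      ≤ activeCount G p * (3 ^ k * (2 ^ n) ^ k)
  k-phases zero t p E wf = ≤-reflexive (regroup (activeCount G p))
    where
      regroup : ∀ a → (a + 0) * 1 ≡ a * (1 * 1)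
      regroup = solve-∀
  k-phases (suc k) t p E wf = begin
    ∑ final (voteSequences n (suc k)) * 4 ^ suc k
      ≡⟨ cong (_* 4 ^ suc k) (∑-product _∷_ final (voteVectors n) (voteSequences n k)) ⟩
    ∑ rest (voteVectors n) * (4 * 4 ^ k)
      ≡⟨ regroup (∑ rest (voteVectors n)) (4 ^ k) ⟩
    (∑ rest (voteVectors n) * 4 ^ k) * 4
      ≡⟨ cong (_* 4) (∑-*ʳ rest (4 ^ k) (voteVectors n)) ⟩
    ∑ (λ x → rest x * 4 ^ k) (voteVectors n) * 4
      ≤⟨ *-monoˡ-≤ 4 (∑-mono IH (voteVectors n)) ⟩
    ∑ (λ x → next x * K) (voteVectors n) * 4
      ≡⟨ cong (_* 4) (sym (∑-*ʳ next K (voteVectors n))) ⟩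
    (∑ next (voteVectors n) * K) * 4
      ≡⟨ regroup′ (∑ next (voteVectors n)) K ⟩
    (∑ next (voteVectors n) * 4) * K
      ≤⟨ *-monoˡ-≤ K (one-phase t p E wf) ⟩
    (activeCount G p * (3 * 2 ^ n)) * K
      ≡⟨ regroup″ (activeCount G p) (3 ^ k) ((2 ^ n) ^ k) (2 ^ n) ⟩
    activeCount G p * (3 ^ suc k * (2 ^ n) ^ suc k) ∎
    where
      open ≤-Reasoning
      final : Vec (Vec Bool n) (suc k) → ℕ
      final ω = activeCount G (proj₁ (runFrom res t (p , E) ω))
      rest : Vec Bool n → ℕ
      rest x = ∑ (λ ω → final (x ∷ ω)) (voteSequences n k)
      next : Vec Bool n → ℕ
      next x = activeCount G (after t p E x)
      K : ℕ
      K = 3 ^ k * (2 ^ n) ^ k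
      IH : ∀ x → rest x * 4 ^ k ≤ next x * K
      IH x = k-phases k (suc t) _ _ (phase-wellFormed G res t p E (lookup x) wf)
      regroup : ∀ a b → a * (4 * b) ≡ (a * b) * 4
      regroup = solve-∀
      regroup′ : ∀ a b → (a * b) * 4 ≡ (a * 4) * b
      regroup′ = solve-∀
      regroup″ : ∀ a b c d → (a * (3 * d)) * (b * c) ≡ a * ((3 * b) * (d * c))
      regroup″ = solve-∀

-- Markov's inequality in counting form: each x with f x > T adds more than T to ∑ f.
markov : {A : Set} (f : A → ℕ) (T : ℕ) (xs : List A) →
  length xs * T ≤ length (filter (λ x → f x ≤? T) xs) * T + ∑ f xs
markov f T [] = z≤n
markov f T (x ∷ xs) = by-cases (f x ≤? T)
  where
    small? : Decidable (λ y → f y ≤ T)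
    small? y = f y ≤? T
    B S : ℕ
    B = length (filter small? xs) * T
    S = ∑ f xs
    by-cases : Dec (f x ≤ T) → T + length xs * T ≤ length (filter small? (x ∷ xs)) * T + (f x + S)
    by-cases (yes fx≤T) rewrite filter-accept small? {x} {xs} fx≤T = begin
      T + length xs * T    ≤⟨ +-monoʳ-≤ T (markov f T xs) ⟩
      T + (B + S)          ≡⟨ sym (+-assoc T B S) ⟩
      T + B + S            ≤⟨ +-monoʳ-≤ (T + B) (m≤n+m S (f x)) ⟩
      T + B + (f x + S)    ∎
      where open ≤-Reasoning
    by-cases (no fx≰T) rewrite filter-reject small? {x} {xs} fx≰T = begin
      T + length xs * T    ≤⟨ +-mono-≤ (<⇒≤ (≰⇒> fx≰T)) (markov f T xs) ⟩
      f x + (B + S)        ≡⟨ rotate (f x) B S ⟩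
      B + (f x + S)        ∎
      where
        open ≤-Reasoning
        rotate : ∀ a b c → a + (b + c) ≡ b + (a + c)
        rotate = solve-∀

*-^-distrib : ∀ a b k → (a * b) ^ k ≡ a ^ k * b ^ k
*-^-distrib a b zero = refl
*-^-distrib a b (suc k) = trans (cong (a * b *_) (*-^-distrib a b k)) (interchange a b (a ^ k) (b ^ k))
  where
    interchange : ∀ a b c d → a * b * (c * d) ≡ a * c * (b * d)
    interchange = solve-∀

cancel-factor : ∀ n {a b} → (n ≡ 0 → a ≤ b) → n * a ≤ n * b → a ≤ b
cancel-factor zero    if-zero _  = if-zero refl
cancel-factor (suc m) _       le = *-cancelˡ-≤ (suc m) le

∸-*-bound : ∀ a b L g → a * L ≤ b * L + g → (a ∸ b) * L ≤ g
∸-*-bound a b L g le = subst (_≤ g) (sym (*-distribʳ-∸ L a b)) (m≤n+o⇒m∸n≤o (a * L) (b * L) le)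

module GoodRuns {n : ℕ} (G : Graph n) (res : Resolver n) (k : ℕ) where
  open Expectation G res

  runs : List (Vec (Vec Bool n) k)
  runs = voteSequences n k

  L : ℕ
  L = length runs

  survivors : Vec (Vec Bool n) k → ℕ
  survivors ω = activeCount G (proj₁ (afterPhases G res ω)) * 8 ^ k

  threshold : ℕ
  threshold = 7 ^ k * n

  good? : Decidable (λ ω → survivors ω ≤ threshold)
  good? ω = survivors ω ≤? threshold

  goodRuns : List (Vec (Vec Bool n) k)
  goodRuns = filter good? runs

  goodRuns-unique : Unique goodRuns
  goodRuns-unique = filter⁺ good? (vectors-unique (voteVectors n) k (voteVectors-unique n))

  goodRuns-few : All (λ ω → FewOngoing G (proj₁ (afterPhases G res ω)) k) goodRuns
  goodRuns-few = All.map (λ {ω} → few {ω}) (all-filter good? runs)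
    where
      few : ∀ {ω} → survivors ω ≤ threshold → FewOngoing G (proj₁ (afterPhases G res ω)) k
      few good vs unique ongoing = ≤-trans (*-monoˡ-≤ (8 ^ k) (ongoing≤activeCount G _ vs unique ongoing)) good

  -- The expectation bound (3/4)^k·n, scaled: ∑ survivors ≤ n · 6^k · L.
  survivors-sum : ∑ survivors runs ≤ n * (6 ^ k * L)
  survivors-sum = begin
    ∑ survivors runs
      ≡⟨ ∑-cong (λ ω → trans (cong (count ω *_) (*-^-distrib 4 2 k)) (sym (*-assoc (count ω) (4 ^ k) (2 ^ k)))) runs ⟩
    ∑ (λ ω → count ω * 4 ^ k * 2 ^ k) runs
      ≡⟨ sym (∑-*ʳ _ (2 ^ k) runs) ⟩
    ∑ (λ ω → count ω * 4 ^ k) runs * 2 ^ k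
      ≡⟨ cong (_* 2 ^ k) (sym (∑-*ʳ count (4 ^ k) runs)) ⟩
    ∑ count runs * 4 ^ k * 2 ^ k
      ≤⟨ *-monoˡ-≤ (2 ^ k) (k-phases k 0 (λ v → v) G initial) ⟩
    activeCount G (λ v → v) * (3 ^ k * (2 ^ n) ^ k) * 2 ^ k
      ≤⟨ *-monoˡ-≤ (2 ^ k) (*-monoˡ-≤ (3 ^ k * (2 ^ n) ^ k) (activeCount≤n G (λ v → v))) ⟩
    n * (3 ^ k * (2 ^ n) ^ k) * 2 ^ k
      ≡⟨ cong (λ z → n * (3 ^ k * z) * 2 ^ k) (sym (length-voteSequences n k)) ⟩
    n * (3 ^ k * L) * 2 ^ k
      ≡⟨ regroup n (3 ^ k) L (2 ^ k) ⟩
    n * (3 ^ k * 2 ^ k * L)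
      ≡⟨ cong (λ z → n * (z * L)) (sym (*-^-distrib 3 2 k)) ⟩
    n * (6 ^ k * L) ∎
    where
      open ≤-Reasoning
      count : Vec (Vec Bool n) k → ℕ
      count ω = activeCount G (proj₁ (afterPhases G res ω))
      initial : WellFormed G (λ v → v) G
      initial = (λ u → refl) , sym (map-id G)
      regroup : ∀ a b c d → a * (b * c) * d ≡ a * (b * d * c)
      regroup = solve-∀

  all-good-if-empty : n ≡ 0 → length goodRuns ≡ L
  all-good-if-empty n≡0 = cong length (filter-all good? {runs} (All.tabulate (λ {ω} _ → good ω)))
    where
      good : ∀ ω → survivors ω ≤ threshold
      good ω = subst (λ c → c * 8 ^ k ≤ threshold) (sym (n≤0⇒n≡0 (subst (count ≤_) n≡0 (activeCount≤n G q)))) z≤n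
        where
          q : Parents n
          q = proj₁ (afterPhases G res ω)
          count : ℕ
          count = activeCount G q

  -- Markov: at most a (6/7)^k fraction of the runs is bad.
  goodRuns-many : (7 ^ k ∸ 6 ^ k) * 2 ^ (n * k) ≤ length goodRuns * 7 ^ k
  goodRuns-many =
    subst (λ z → (7 ^ k ∸ 6 ^ k) * z ≤ length goodRuns * 7 ^ k)
      (trans (length-voteSequences n k) (^-*-assoc 2 n k))
      (∸-*-bound (7 ^ k) (6 ^ k) L _ (cancel-factor n if-empty scaled))
    where
      open ≤-Reasoning
      B : ℕ
      B = length goodRuns
      scaled : n * (7 ^ k * L) ≤ n * (6 ^ k * L + B * 7 ^ k)
      scaled = begin
        n * (7 ^ k * L)                  ≡⟨ regroup n (7 ^ k) L ⟩
        L * threshold                    ≤⟨ markov survivors threshold runs ⟩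
        B * threshold + ∑ survivors runs ≤⟨ +-monoʳ-≤ (B * threshold) survivors-sum ⟩
        B * threshold + n * (6 ^ k * L)  ≡⟨ regroup′ n (7 ^ k) L B (6 ^ k) ⟩
        n * (6 ^ k * L + B * 7 ^ k)      ∎
        where
          regroup : ∀ a b c → a * (b * c) ≡ c * (b * a)
          regroup = solve-∀
          regroup′ : ∀ a b c d e → d * (b * a) + a * (e * c) ≡ a * (e * c + d * b)
          regroup′ = solve-∀
      if-empty : n ≡ 0 → 7 ^ k * L ≤ 6 ^ k * L + B * 7 ^ k
      if-empty n≡0 = subst (λ g → 7 ^ k * L ≤ 6 ^ k * L + g * 7 ^ k) (sym (all-good-if-empty n≡0))
        (≤-trans (≤-reflexive (*-comm (7 ^ k) L)) (m≤n+m (L * 7 ^ k) (6 ^ k * L)))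

corollary3p4 : (n : ℕ) (G : Graph n) (res : Resolver n) (k : ℕ) →
    ∃ λ (good : List (Vec (Vec Bool n) k)) →
    Unique good ×
    All (λ ω → FewOngoing G (proj₁ (afterPhases G res ω)) k) good ×
    (7 ^ k ∸ 6 ^ k) * 2 ^ (n * k) ≤ length good * 7 ^ k
corollary3p4 n G res k = goodRuns , goodRuns-unique , goodRuns-few , goodRuns-many
  where open GoodRuns G res k
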